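{- The inference rule $+\partial_{||}$ is consistent: for every propositional defeasible theory $D$ and every proposition $q$, if both $+\partial_{||} q$ and $+\partial_{||} \neg q$ are consequences of $D$, then both $+\Delta q$ and $+\Delta \neg q$ are consequences of $D$.
   Context: Literals are propositions $p$ or their negations $\neg p$; for a literal $q$, ${\sim}q$ denotes its complement. A (propositional) defeasible theory is a triple $D=(F,R,>)$ where $F$ is a finite set of literals (facts), $R$ is a finite set of rules, and $>$ (the superiority relation) is an acyclic binary relation on $R$. Each rule $r$ has a finite set $A(r)$ of literals (its antecedent), a literal (its consequent), and is strict ($A(r)\rightarrow q$), defeasible ($A(r)\Rightarrow q$) or a defeater ($A(r)\leadsto q$). $R_s$ is the set of strict rules, $R_{sd}$ the set of strict and defeasible rules, and $R[q]$ the set of rules of $R$ with consequent $q$. A proof $P$ is a finite sequence of tagged literals, $P(1..i)$ its first $i$ elements, each element appended according to an inference rule. $+\Delta$: append $+\Delta q$ if $q\in F$, or there is $r\in R_s[q]$ with $+\Delta a\in P(1..i)$ for all $a\in A(r)$. $-\Delta$: append $-\Delta q$ if $q\notin F$ and for every $r\in R_s[q]$ there is $a\in A(r)$ with $-\Delta a\in P(1..i)$. $P_\Delta$ is the set of all $\pm\Delta$ conclusions derivable from $D$. $+\lambda$: append $+\lambda q$ if (1) $+\Delta q\in P_\Delta$, or (2) there is $r\in R_{sd}[q]$ with $+\lambda a\in P(1..i)$ for all $a\in A(r)$, and $+\Delta{\sim}q\notin P_\Delta$. $P_\lambda$ is the set of all $+\lambda$ conclusions derivable. $+\partial_{||}$: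 append $+\partial_{||}q$ if (1) $+\Delta q\in P_\Delta$, or (2) all of: (2.1) there is $r\in R_{sd}[q]$ with $+\partial_{||}a\in P(1..i)$ for all $a\in A(r)$; (2.2) $+\Delta{\sim}q\notin P_\Delta$; (2.3) for every $s\in R[{\sim}q]$ either (2.3.1) there is $a\in A(s)$ with $+\lambda a\notin P_\lambda$, or (2.3.2) there is $t\in R_{sd}[q]$ with $+\partial_{||}a\in P(1..i)$ for all $a\in A(t)$ and $t>s$. $+d\,q$ is a consequence of $D$ if it occurs in some proof (using the precomputed closures $P_\Delta,P_\lambda$). -}

module Defs where

open import Data.Nat using (ℕ)
open import Data.Fin using (Fin)
open import Data.List using (List; []; _∷_)
open import Data.List.Membership.Propositional using (_∈_; _∉_)
open import Data.List.Relation.Unary.All using (All)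
open import Data.List.Relation.Unary.Any using (Any)
open import Data.Product using (Σ; ∃; _×_; _,_)
open import Data.Sum using (_⊎_)
open import Relation.Nullary using (¬_)
open import Relation.Binary.PropositionalEquality using (_≡_)
open import Relation.Binary.Construct.Closure.Transitive using (TransClosure)

data Literal (A : Set) : Set where
  pos : A → Literal A
  neg : A → Literal A

∼_ : {A : Set} → Literal A → Literal A
∼ pos p = neg p
∼ neg p = pos p

data Kind : Set where
  strict defeasible defeater : Kind

record Rule (A : Set) : Set where
  constructor mkRule
  field
    ante   : List (Literal A)
    kind   : Kind
    conseq : Literal A

open Rule public

-- The finite rule set R is indexed by
-- Fin nRules (so distinct rules are distinguished by their labels), the
-- superiority relation is a finite list of pairs (t , s) meaning t > s, and
-- it is required to be acyclic (its transitive closure is irreflexive).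
record Theory (A : Set) : Set where
  field
    facts  : List (Literal A)
    nRules : ℕ
    rule   : Fin nRules → Rule A
    sup    : List (Fin nRules × Fin nRules)
    acyclic : ∀ r → ¬ TransClosure (λ t s → (t , s) ∈ sup) r r

open Theory public

data DTag : Set where
  +Δ -Δ : DTag

module _ {A : Set} (D : Theory A) where

  RuleIx : Set
  RuleIx = Fin (nRules D)

  _≻_ : RuleIx → RuleIx → Set
  t ≻ s = (t , s) ∈ sup D

  IsStrict : RuleIx → Set
  IsStrict r = kind (rule D r) ≡ strict

  IsSD : RuleIx → Set
  IsSD r = (kind (rule D r) ≡ strict) ⊎ (kind (rule D r) ≡ defeasible)

  Concl : RuleIx → Literal A → Set
  Concl r q = conseq (rule D r) ≡ q

  Ante : RuleIx → List (Literal A)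
  Ante r = ante (rule D r)

  DLit : Set
  DLit = DTag × Literal A

  -- Conditions for appending a tagged literal to the prefix P(1..i)
  -- (a proof prefix is stored as a list, most recent element first;
  -- only membership in it matters).
  DStep : List DLit → DLit → Set
  DStep P (+Δ , q) =
    (q ∈ facts D) ⊎
    (Σ RuleIx λ r → IsStrict r × Concl r q × All (λ a → (+Δ , a) ∈ P) (Ante r))
  DStep P (-Δ , q) =
    (q ∉ facts D) ×
    (∀ r → IsStrict r → Concl r q → Any (λ a → (-Δ , a) ∈ P) (Ante r))

  data DProof : List DLit → Set where
    []  : DProof []
    _▷_ : ∀ {P x} → DProof P → DStep P x → DProof (x ∷ P)

  PΔ : DLit → Set
  PΔ x = Σ (List DLit) λ P → DProof P × x ∈ P

  -- +λ proofs (a prefix lists the literals q with +λ q)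
  λStep : List (Literal A) → Literal A → Set
  λStep P q =
    PΔ (+Δ , q) ⊎
    ((Σ RuleIx λ r → IsSD r × Concl r q × All (λ a → a ∈ P) (Ante r))
      × ¬ PΔ (+Δ , ∼ q))

  data λProof : List (Literal A) → Set where
    []  : λProof []
    _▷_ : ∀ {P q} → λProof P → λStep P q → λProof (q ∷ P)

  Pλ : Literal A → Set
  Pλ q = Σ (List (Literal A)) λ P → λProof P × q ∈ P

  -- +∂_|| proofs (a prefix lists the literals q with +∂_|| q)
  ∂Step : List (Literal A) → Literal A → Set
  ∂Step P q =
    PΔ (+Δ , q) ⊎
    ( (Σ RuleIx λ r → IsSD r × Concl r q × All (λ a → a ∈ P) (Ante r))
    × ¬ PΔ (+Δ , ∼ q)
    × (∀ s → Concl s (∼ q) →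
          Any (λ a → ¬ Pλ a) (Ante s)
          ⊎ (Σ RuleIx λ t → IsSD t × Concl t q
               × All (λ a → a ∈ P) (Ante t) × (t ≻ s))))

  data ∂Proof : List (Literal A) → Set where
    []  : ∂Proof []
    _▷_ : ∀ {P q} → ∂Proof P → ∂Step P q → ∂Proof (q ∷ P)

  P∂ : Literal A → Set
  P∂ q = Σ (List (Literal A)) λ P → ∂Proof P × q ∈ P

module Submission where

-- Inverting the last step that proves a literal x gives either +Δ x, or
-- the defeasible branch (2), which in particular rules out +Δ ∼x (2.2).
-- So either both literals are definitely provable (the claim), or one is
-- +Δ and the other's branch (2) denies it (absurd), or both are proved by
-- branch (2).  In the last case consider the rules for q or ¬q whose
-- antecedents are all +λ-provable ("applicable" rules).  Since every
-- +∂_|| conclusion is also a +λ conclusion, condition (2.3) for x says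
-- that every applicable rule for ∼x is beaten (via >) by an applicable
-- rule for x.  Branch (2.1) supplies one applicable rule, so the
-- applicable rules for q or ¬q form a nonempty set with no >-maximal
-- element; on the finite set of rules this contradicts acyclicity of >.

open import Defs
open import Data.Product using (Σ; _×_; _,_; proj₁; proj₂)
open import Data.Nat as ℕ using (ℕ; zero; suc)
open import Data.Nat.Properties using (m<1+n⇒m<n∨m≡n; ≤-refl)
open import Data.Fin using (Fin; toℕ)
open import Data.Fin.Properties using (pigeonhole)
open import Data.List using (List; []; _∷_)
open import Data.List.Membership.Propositional using (_∈_)
open import Data.List.Relation.Unary.All as All using (All)
open import Data.List.Relation.Unary.Any using (here; there)
open import Data.Sum using (_⊎_; inj₁; inj₂)
open import Data.Empty using (⊥; ⊥-elim)
open import Relation.Nullary using (¬_)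
open import Relation.Binary.PropositionalEquality using (refl; subst)
open import Relation.Binary.Construct.Closure.Transitive using (TransClosure; [_]; _∷_)

-- An acyclic relation _>_ on Fin n admits no nonempty predicate G in which
-- every element is exceeded by another element of G: iterating "go up"
-- n+1 times must, by pigeonhole, revisit a node, yielding a cycle.
acyclic⇒bounded : ∀ {n} (_>_ : Fin n → Fin n → Set) →
                  (∀ r → ¬ TransClosure _>_ r r) →
                  (G : Fin n → Set) → (∀ s → G s → Σ (Fin n) λ t → G t × t > s) →
                  ∀ s → ¬ G s
acyclic⇒bounded {n} _>_ acyc G up s g = acyc (proj₁ cycle) (proj₂ cycle)
  where
  ascent : ℕ → Σ (Fin n) G
  ascent zero    = s , g
  ascent (suc k) = let (t , g′ , _) = up (proj₁ (ascent k)) (proj₂ (ascent k)) in t , g′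

  a : ℕ → Fin n
  a k = proj₁ (ascent k)

  ascends : ∀ k → a (suc k) > a k
  ascends k = proj₂ (proj₂ (up (a k) (proj₂ (ascent k))))

  increasing : ∀ {m k} → m ℕ.< k → TransClosure _>_ (a k) (a m)
  increasing {m} {suc k} m<1+k with m<1+n⇒m<n∨m≡n m<1+k
  ... | inj₁ m<k  = ascends k ∷ increasing m<k
  ... | inj₂ refl = [ ascends k ]

  cycle : Σ (Fin n) λ r → TransClosure _>_ r r
  cycle with pigeonhole ≤-refl (λ (i : Fin (suc n)) → a (toℕ i))
  ... | i , j , i<j , aᵢ≡aⱼ =
    a (toℕ j) , subst (TransClosure _>_ (a (toℕ j))) aᵢ≡aⱼ (increasing i<j)

module _ {A : Set} (D : Theory A) where

  -- Every +∂_|| proof can be replayed as a +λ proof of a superset: both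
  -- branches of +∂_|| are special cases of the corresponding +λ branches.
  ∂⇒λ : ∀ {P} → ∂Proof D P → Σ (List (Literal A)) λ L → λProof D L × (∀ {a} → a ∈ P → a ∈ L)
  ∂⇒λ []             = [] , [] , λ ()
  ∂⇒λ (_▷_ {q = q} pp st) =
    let (L , lp , P⊆L) = ∂⇒λ pp
        extend : ∀ {a} → a ∈ q ∷ _ → a ∈ q ∷ L
        extend = λ { (here e) → here e ; (there m) → there (P⊆L m) }
    in q ∷ L , lp ▷ replay P⊆L st , extend
    where
    replay : ∀ {P L q} → (∀ {a} → a ∈ P → a ∈ L) → ∂Step D P q → λStep D L q
    replay _   (inj₁ Δq) = inj₁ Δq
    replay P⊆L (inj₂ ((r , sd , c , ante) , ¬Δ∼q , _)) =
      inj₂ ((r , sd , c , All.map P⊆L ante) , ¬Δ∼q)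

  ∂-member⇒λ : ∀ {P a} → ∂Proof D P → a ∈ P → Pλ D a
  ∂-member⇒λ pp a∈P = let (L , lp , P⊆L) = ∂⇒λ pp in L , lp , P⊆L a∈P

  stepOf : ∀ {P q} → ∂Proof D P → q ∈ P → Σ (List (Literal A)) λ P′ → ∂Proof D P′ × ∂Step D P′ q
  stepOf (pp ▷ st) (here refl) = _ , pp , st
  stepOf (pp ▷ _)  (there q∈P) = stepOf pp q∈P

  Applicable : Literal A → RuleIx D → Set
  Applicable x t = Concl D t x × All (Pλ D) (Ante D t)

  record Supported (x : Literal A) : Set where
    field
      notΔ∼ : ¬ PΔ D (+Δ , ∼ x)
      rule₀ : Σ (RuleIx D) (Applicable x)
      beats : ∀ s → Applicable (∼ x) s → Σ (RuleIx D) λ t → Applicable x t × _≻_ D t s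

  -- An applicable attacker cannot be dismissed by clause (2.3.1), so
  -- clause (2.3.2) must provide the superior rule.
  ∂-inversion : ∀ {x} → P∂ D x → PΔ D (+Δ , x) ⊎ Supported x
  ∂-inversion (P , pp , x∈P) with stepOf pp x∈P
  ... | _ , _  , inj₁ Δx = inj₁ Δx
  ... | _ , pp′ , inj₂ ((r , _ , c , ante) , ¬Δ∼x , attacks) = inj₂ record
    { notΔ∼ = ¬Δ∼x
    ; rule₀ = r , c , All.map (∂-member⇒λ pp′) ante
    ; beats = beaten
    }
    where
    beaten : ∀ s → Applicable _ s → Σ (RuleIx D) λ t → Applicable _ t × _≻_ D t s
    beaten s (c∼ , λ-ante) with attacks s c∼
    ... | inj₁ unproved = ⊥-elim (All.lookupWith (λ λa ¬λa → ¬λa λa) λ-ante unproved)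
    ... | inj₂ (t , _ , ct , ante-t , t≻s) = t , (ct , All.map (∂-member⇒λ pp′) ante-t) , t≻s

  -- Two complementary supported literals are impossible: the applicable rules
  -- for p or ¬p would have no >-maximal element.
  ¬bothSupported : ∀ p → Supported (pos p) → Supported (neg p) → ⊥
  ¬bothSupported p sp sn =
    acyclic⇒bounded (_≻_ D) (acyclic D) ForEither up r (inj₁ app)
    where
    open Supported
    ForEither : RuleIx D → Set
    ForEither t = Applicable (pos p) t ⊎ Applicable (neg p) t

    up : ∀ s → ForEither s → Σ (RuleIx D) λ t → ForEither t × _≻_ D t s
    up s (inj₁ app) = let (t , app′ , t≻s) = beats sn s app in t , inj₂ app′ , t≻s
    up s (inj₂ app) = let (t , app′ , t≻s) = beats sp s app in t , inj₁ app′ , t≻s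

    r = proj₁ (rule₀ sp)
    app = proj₂ (rule₀ sp)

proposition1 : {A : Set} (D : Theory A) (q : A) →
               P∂ D (pos q) → P∂ D (neg q) →
               PΔ D (+Δ , pos q) × PΔ D (+Δ , neg q)
proposition1 D q ∂q ∂¬q with ∂-inversion D ∂q | ∂-inversion D ∂¬q
... | inj₁ Δq  | inj₁ Δ¬q = Δq , Δ¬q
... | inj₁ Δq  | inj₂ s¬q = ⊥-elim (Supported.notΔ∼ s¬q Δq)
... | inj₂ sq  | inj₁ Δ¬q = ⊥-elim (Supported.notΔ∼ sq Δ¬q)
... | inj₂ sq  | inj₂ s¬q = ⊥-elim (¬bothSupported D q sq s¬q)
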